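{- Let $a_{1}<a_{2}<a_{3}<\cdots$ be a strictly increasing infinite sequence of positive integers, let $A=\{a_{1},a_{2},a_{3},\ldots\}$, and let $n>0$ be an integer such that: (1) whenever $m>n$, there exist indices $i<r\leq s<j$ with $a_{m}=a_{i}+a_{j}=a_{r}+a_{s}$; and (2) whenever $a=a_{i}+a_{j}=a_{r}+a_{s}>a_{n}$ for some indices $i<r<s<j$, then $a=a_{m}$ for some $m>n$. Suppose $d_{1},d_{2},x,y$ are integers with $x\neq d_{1}$, $d_{1}\neq d_{2}$, $d_{2}\neq y$, such that \[ \{d_{1},2d_{1},x,x+d_{1},x+2d_{1}\}\cup\{d_{2},2d_{2},y,y+d_{2},y+2d_{2}\}\subseteq A, \] \[ \{x,x+d_{1}\}\cap\{y,y+d_{2}\}\neq\varnothing, \] and $d_{1}+d_{2}>a_{n}$. Then there exists an integer $k\geq 1$ such that every positive multiple of $k$ belongs to $A$. -}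

module Defs where

open import Data.Nat using (ℕ; _≤_; _<_)
open import Data.Integer using (ℤ; +_)
open import Data.Product using (∃; _×_)
open import Relation.Binary.PropositionalEquality using (_≡_)

-- The sequence a₁ < a₂ < ... is modelled as a : ℕ → ℕ, only the values at
-- indices ≥ 1 are relevant (a 0 is ignored).

InA : (ℕ → ℕ) → ℤ → Set
InA a z = ∃ λ m → 1 ≤ m × + (a m) ≡ z

{-# OPTIONS --safe #-}
-- Only condition (2) matters, read as: the terms are closed under p + s whenever p < q < r < s
-- are terms with p + s = q + r > aₙ. Let e be the larger of d₁, d₂ and u the matching x or y,
-- so that 2e ≥ d₁ + d₂ > aₙ.
-- The quadruples (e, 2e, w, w + e) extend u, u + e, u + 2e to the whole progression u + ℕe
-- (u ≠ e keeps 2e and u + e apart), and the quadruples (u, u + e, v + (t+1)e, v + (t+2)e) carry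
-- a progression v + ℕe with v > u over to v + k + ℕe, where k = u + 2e. Starting from v = k,
-- every multiple of k is a term.
module Submission where

open import Defs
open import Data.Nat using (ℕ; _≤_; _<_)
open import Data.Product using (∃; _×_; _,_)
open import Data.Sum using (_⊎_; inj₁; inj₂)
open import Relation.Binary.PropositionalEquality using (_≡_; _≢_; refl; sym; trans; cong; subst; ≢-sym)
open import Relation.Nullary using (¬_; contradiction)

module _ where
  open import Data.Nat using (suc; _+_; _*_)
  open import Data.Nat.Properties
  open import Data.Nat.Tactic.RingSolver using (solve-∀)
  open import Relation.Binary.Definitions using (tri<; tri≈; tri>)
  open import Data.Integer as ℤ using (+_)
  open import Data.Integer.Properties using (+-injective; pos-*)

  <-sum⇒<-double : ∀ {c x y} → c < x + y → c < x + x ⊎ c < y + y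
  <-sum⇒<-double {x = x} {y} c<x+y with ≤-total x y
  ... | inj₁ x≤y = inj₂ (<-≤-trans c<x+y (+-monoˡ-≤ y x≤y))
  ... | inj₂ y≤x = inj₁ (<-≤-trans c<x+y (+-monoʳ-≤ x y≤x))

  module SumClosed
      (P : ℕ → Set) (c : ℕ)
      (positive : ∀ {v} → P v → 0 < v)
      (closed : ∀ {p q r s} → P p → P q → P r → P s → p < q → q < r → r < s
              → p + s ≡ q + r → c < p + s → P (p + s))
    where

    closed-≢ : ∀ {p q r s} → P p → P q → P r → P s → p < q → p < r → q < s → r < s → q ≢ r
             → p + s ≡ q + r → c < p + s → P (p + s)
    closed-≢ {q = q} {r} p∈P q∈P r∈P s∈P p<q p<r q<s r<s q≢r p+s≡q+r c<p+s with <-cmp q r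
    ... | tri< q<r _ _ = closed p∈P q∈P r∈P s∈P p<q q<r r<s p+s≡q+r c<p+s
    ... | tri≈ _ q≡r _ = contradiction q≡r q≢r
    ... | tri> _ _ r<q = closed p∈P r∈P q∈P s∈P p<r r<q q<s (trans p+s≡q+r (+-comm q r)) c<p+s

    Progression : ℕ → ℕ → Set
    Progression v e = ∀ t → P (v + t * e)

    module _ {e : ℕ} (e∈P : P e) (2e∈P : P (e + e)) (c<2e : c < e + e) where

      next-term : ∀ {w} → P w → P (w + e) → e < w → w ≢ e + e → P (w + (e + e))
      next-term {w} w∈P w+e∈P e<w w≢2e =
        subst P (rearrange e w)
          (closed-≢ e∈P 2e∈P w∈P w+e∈P (m<m+n e 0<e) e<w (+-monoˡ-< e e<w) (m<m+n w 0<e)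
            (≢-sym w≢2e) (regroup e w) (<-≤-trans c<2e (+-monoʳ-≤ e (m≤n+m e w))))
        where
        0<e : 0 < e
        0<e = positive e∈P
        regroup : ∀ e w → e + (w + e) ≡ (e + e) + w
        regroup = solve-∀
        rearrange : ∀ e w → e + (w + e) ≡ w + (e + e)
        rearrange = solve-∀

      progression : ∀ {u} → P u → P (u + e) → P (u + (e + e)) → u ≢ e → Progression u e
      progression {u} u∈P u+e∈P u+2e∈P u≢e = term
        where
        term : Progression u e
        term 0 = subst P (sym (+-identityʳ u)) u∈P
        term 1 = subst P (cong (λ d → u + d) (sym (*-identityˡ e))) u+e∈P
        term 2 = subst P (cong (λ d → u + (e + d)) (sym (*-identityˡ e))) u+2e∈P
        term (suc (suc (suc t))) =
          subst P (sym (shift₂ u e t))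
            (next-term (term (suc t)) (subst P (shift₁ u e t) (term (suc (suc t))))
              (+-mono-<-≤ (positive u∈P) (m≤m+n e (t * e))) (term≢2e t))
          where
          shift₁ : ∀ u e t → u + suc (suc t) * e ≡ (u + suc t * e) + e
          shift₁ = solve-∀
          shift₂ : ∀ u e t → u + suc (suc (suc t)) * e ≡ (u + suc t * e) + (e + e)
          shift₂ = solve-∀
          term≢2e : ∀ t → u + suc t * e ≢ e + e
          term≢2e 0 eq = u≢e (+-cancelʳ-≡ e u e (trans (cong (λ d → u + d) (sym (*-identityˡ e))) eq))
          term≢2e (suc t) = >⇒≢ (+-mono-<-≤ (positive u∈P) (+-monoʳ-≤ e (m≤m+n e (t * e))))

    translate : ∀ {e u v} → 0 < e → c < e + e → P u → P (u + e) → u < v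
          → Progression v e → Progression (v + (u + (e + e))) e
    translate {e} {u} {v} 0<e c<2e u∈P u+e∈P u<v v∈ t =
      subst P (rearrange u v e t)
        (closed u∈P u+e∈P (v∈ (suc t)) (v∈ (suc (suc t)))
          (m<m+n u 0<e) (+-mono-<-≤ u<v (m≤m+n e (t * e))) (+-monoʳ-< v (m<n+m (suc t * e) 0<e))
          (regroup u v e t) (<-≤-trans c<2e 2e≤sum))
      where
      regroup : ∀ u v e t → u + (v + suc (suc t) * e) ≡ (u + e) + (v + suc t * e)
      regroup = solve-∀
      rearrange : ∀ u v e t → u + (v + suc (suc t) * e) ≡ v + (u + (e + e)) + t * e
      rearrange = solve-∀
      2e≤sum : e + e ≤ u + (v + suc (suc t) * e)
      2e≤sum = ≤-trans (+-monoʳ-≤ e (m≤m+n e (t * e))) (≤-trans (m≤n+m _ v) (m≤n+m _ u))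

    multiples : ∀ {e u} → P e → P (e + e) → c < e + e → P u → P (u + e) → P (u + (e + e)) → u ≢ e
              → ∀ t → 1 ≤ t → P (t * (u + (e + e)))
    multiples {e} {u} e∈P 2e∈P c<2e u∈P u+e∈P u+2e∈P u≢e (suc r) _ =
      subst P (+-identityʳ (suc r * k)) (row r 0)
      where
      k : ℕ
      k = u + (e + e)
      row : ∀ r → Progression (suc r * k) e
      row 0 t = subst P (first-row u e t) (progression e∈P 2e∈P c<2e u∈P u+e∈P u+2e∈P u≢e (suc (suc t)))
        where
        first-row : ∀ u e t → u + suc (suc t) * e ≡ 1 * (u + (e + e)) + t * e
        first-row = solve-∀
      row (suc r) = subst (λ v → Progression v e) (+-comm (suc r * k) k)
        (translate (positive e∈P) c<2e u∈P u+e∈P (<-≤-trans (m<m+n u (positive 2e∈P)) (m≤m+n k (r * k))) (row r))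

  module IncreasingSequence
      (a : ℕ → ℕ) (n : ℕ)
      (increasing : ∀ i j → 1 ≤ i → i < j → a i < a j)
      (positive : ∀ i → 1 ≤ i → 0 < a i)
      (0<n : 0 < n)
      (condition₂ : ∀ i r s j → 1 ≤ i → i < r → r < s → s < j → a i + a j ≡ a r + a s
                  → a n < a i + a j → ∃ λ m → n < m × a m ≡ a i + a j)
    where

    IsTerm : ℕ → Set
    IsTerm v = ∃ λ m → 1 ≤ m × a m ≡ v

    isTerm-positive : ∀ {v} → IsTerm v → 0 < v
    isTerm-positive (m , 1≤m , refl) = positive m 1≤m

    index-< : ∀ {i j} → 1 ≤ j → a i < a j → i < j
    index-< {i} {j} 1≤j aᵢ<aⱼ with <-cmp i j
    ... | tri< i<j _ _ = i<j
    ... | tri≈ _ refl _ = contradiction aᵢ<aⱼ (<-irrefl refl)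
    ... | tri> _ _ j<i = contradiction aᵢ<aⱼ (<-asym (increasing j i 1≤j j<i))

    isTerm-closed : ∀ {p q r s} → IsTerm p → IsTerm q → IsTerm r → IsTerm s → p < q → q < r → r < s
                  → p + s ≡ q + r → a n < p + s → IsTerm (p + s)
    isTerm-closed (i , 1≤i , refl) (k , 1≤k , refl) (l , 1≤l , refl) (j , 1≤j , refl) p<q q<r r<s p+s≡q+r aₙ<p+s
      with condition₂ i k l j 1≤i (index-< 1≤k p<q) (index-< 1≤l q<r) (index-< 1≤j r<s) p+s≡q+r aₙ<p+s
    ... | m , n<m , aₘ≡p+s = m , <-trans 0<n n<m , aₘ≡p+s

    open SumClosed IsTerm (a n) isTerm-positive isTerm-closed

    fromInA : ∀ {v} → InA a (+ v) → IsTerm v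
    fromInA (m , 1≤m , aₘ≡v) = m , 1≤m , +-injective aₘ≡v

    toInA : ∀ {v} → IsTerm v → InA a (+ v)
    toInA (m , 1≤m , aₘ≡v) = m , 1≤m , cong +_ aₘ≡v

    double : ∀ e → + 2 ℤ.* + e ≡ + (e + e)
    double e = trans (sym (pos-* 2 e)) (cong (λ d → + (e + d)) (+-identityʳ e))

    multiplesInA : ∀ {e u} → InA a (+ e) → InA a (+ 2 ℤ.* + e)
                 → InA a (+ u) → InA a (+ u ℤ.+ + e) → InA a (+ u ℤ.+ + 2 ℤ.* + e)
                 → ¬ (+ u ≡ + e) → a n < e + e
                 → ∃ λ k → 1 ≤ k × (∀ t → 1 ≤ t → InA a (+ (t * k)))
    multiplesInA {e} {u} e∈A 2e∈A u∈A u+e∈A u+2e∈A u≢e aₙ<2e =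
      u + (e + e) , <-≤-trans (isTerm-positive u∈) (m≤m+n u (e + e)) ,
      λ t 1≤t → toInA (multiples (fromInA e∈A) 2e∈ aₙ<2e u∈ (fromInA u+e∈A) u+2e∈ u≢ℕe t 1≤t)
      where
      u∈ : IsTerm u
      u∈ = fromInA u∈A
      2e∈ : IsTerm (e + e)
      2e∈ = fromInA (subst (InA a) (double e) 2e∈A)
      u+2e∈ : IsTerm (u + (e + e))
      u+2e∈ = fromInA (subst (InA a) (cong (λ d → + u ℤ.+ d) (double e)) u+2e∈A)
      u≢ℕe : u ≢ e
      u≢ℕe u≡e = u≢e (cong +_ u≡e)

open import Data.Integer using (ℤ; +_; _+_; _*_)
open import Data.Integer.Properties using (drop‿+<+)

lemma2 : (a : ℕ → ℕ) (n : ℕ)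
    → (∀ i j → 1 ≤ i → i < j → a i < a j)
    → (∀ i → 1 ≤ i → 0 < a i)
    → 0 < n
    → (∀ m → n < m → ∃ λ i → ∃ λ r → ∃ λ s → ∃ λ j → 1 ≤ i × i < r × r ≤ s × s < j × a m ≡ Data.Nat._+_ (a i) (a j) × a m ≡ Data.Nat._+_ (a r) (a s))
    → (∀ i r s j → 1 ≤ i → i < r → r < s → s < j → Data.Nat._+_ (a i) (a j) ≡ Data.Nat._+_ (a r) (a s) → a n < Data.Nat._+_ (a i) (a j) → ∃ λ m → n < m × a m ≡ Data.Nat._+_ (a i) (a j))
    → (d₁ d₂ x y : ℤ)
    → ¬ (x ≡ d₁) → ¬ (d₁ ≡ d₂) → ¬ (d₂ ≡ y)
    → InA a d₁ → InA a (+ 2 * d₁) → InA a x → InA a (x + d₁) → InA a (x + + 2 * d₁)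
    → InA a d₂ → InA a (+ 2 * d₂) → InA a y → InA a (y + d₂) → InA a (y + + 2 * d₂)
    → ((x ≡ y) ⊎ (x ≡ y + d₂)) ⊎ ((x + d₁ ≡ y) ⊎ (x + d₁ ≡ y + d₂))
    → Data.Integer._<_ (+ (a n)) (d₁ + d₂)
    → ∃ λ k → 1 ≤ k × (∀ t → 1 ≤ t → InA a (+ (Data.Nat._*_ t k)))
lemma2 a n increasing positive 0<n _ condition₂ d₁ d₂ x y x≢d₁ _ d₂≢y
       d₁∈A@(i , _ , refl) 2d₁∈A x∈A@(_ , _ , refl) x+d₁∈A x+2d₁∈A
       d₂∈A@(j , _ , refl) 2d₂∈A y∈A@(_ , _ , refl) y+d₂∈A y+2d₂∈A _ aₙ<d₁+d₂
  with <-sum⇒<-double {x = a i} {y = a j} (drop‿+<+ aₙ<d₁+d₂)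
... | inj₁ aₙ<2d₁ = multiplesInA d₁∈A 2d₁∈A x∈A x+d₁∈A x+2d₁∈A x≢d₁ aₙ<2d₁
  where open IncreasingSequence a n increasing positive 0<n condition₂
... | inj₂ aₙ<2d₂ = multiplesInA d₂∈A 2d₂∈A y∈A y+d₂∈A y+2d₂∈A (≢-sym d₂≢y) aₙ<2d₂
  where open IncreasingSequence a n increasing positive 0<n condition₂
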